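{- Let $f$ be a nested canalyzing function (NCF) of $n\ge 2$ variables and consider a default-normalized representation of $f$. Two variables of $f$ are symmetric if and only if, in this default-normalized representation, they occur in the same layer and have the same canalyzing value.
   Context: A Boolean function $f(x_1,\dots,x_n)$ is nested canalyzing (an NCF) if there are a permutation $\pi$ of $\{1,\dots,n\}$, canalyzing values $a_1,\dots,a_n\in\{0,1\}$ and canalyzed values $b_1,\dots,b_n\in\{0,1\}$ such that $f$ is computed by the ordered list of rules "$x_{\pi(i)}: a_i\to b_i$" for $i=1,\dots,n$ followed by "Default: $\overline{b_n}$": i.e., $f(x)=b_i$ for the first $i$ with $x_{\pi(i)}=a_i$, and $f(x)=\overline{b_n}$ if $x_{\pi(i)}\neq a_i$ for all $i$. Such a list of $n$ rules (lines) is called a (simplified) representation of $f$; line $i$ tests variable $x_{\pi(i)}$ with canalyzing value $a_i$ and canalyzed value $b_i$. A layer of a representation is a maximal sequence of consecutive lines having the same canalyzed value. For $n\ge 2$, a representation is default-normalized if lines $n-1$ and $n$ have the same canalyzed value (every NCF with $n\ge 2$ variables has such a representation). Two variables of a Boolean function are symmetric if interchanging their values never changes the value of the function. -}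

module Defs where

open import Data.Nat using (ℕ; suc)
open import Data.Fin using (Fin; fromℕ; inject₁; _≤_)
open import Data.Fin.Permutation using (Permutation′; _⟨$⟩ʳ_; _⟨$⟩ˡ_; transpose)
open import Data.Bool using (Bool; not; if_then_else_)
open import Data.Bool.Properties using (_≟_)
open import Data.List using (List; []; _∷_; map; allFin)
open import Data.Product using (_×_; _,_)
open import Data.Sum using (_⊎_)
open import Relation.Nullary using (yes; no)
open import Relation.Binary.PropositionalEquality using (_≡_)

BoolFun : ℕ → Set
BoolFun n = (Fin n → Bool) → Bool

-- A (simplified) representation: line i (i : Fin n, in order) tests variable
-- x_{π(i)} with canalyzing value a i and canalyzed value b i.
record Rep (n : ℕ) : Set where
  field
    π : Permutation′ n
    a : Fin n → Bool
    b : Fin n → Bool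

open Rep public

evalRules : ∀ {n} → List (Fin n × Bool × Bool) → Bool → (Fin n → Bool) → Bool
evalRules [] d x = d
evalRules ((v , α , β) ∷ rs) d x with x v ≟ α
... | yes _ = β
... | no  _ = evalRules rs d x

lastLine : ∀ m → Fin (suc (suc m))
lastLine m = fromℕ (suc m)

secondLastLine : ∀ m → Fin (suc (suc m))
secondLastLine m = inject₁ (fromℕ m)

ruleList : ∀ {n} → Rep n → List (Fin n × Bool × Bool)
ruleList R = map (λ i → (π R ⟨$⟩ʳ i , a R i , b R i)) (allFin _)

evalRep : ∀ m → Rep (suc (suc m)) → BoolFun (suc (suc m))
evalRep m R = evalRules (ruleList R) (not (b R (lastLine m)))

Represents : ∀ m → Rep (suc (suc m)) → BoolFun (suc (suc m)) → Set
Represents m R f = ∀ x → f x ≡ evalRep m R x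

DefaultNormalized : ∀ m → Rep (suc (suc m)) → Set
DefaultNormalized m R = b R (secondLastLine m) ≡ b R (lastLine m)

-- lines i..j (i ≤ j) all have the same canalyzed value, hence lie in one layer
LayerBetween : ∀ {n} → Rep n → Fin n → Fin n → Set
LayerBetween R i j = i ≤ j × (∀ k → i ≤ k → k ≤ j → b R k ≡ b R i)

SameLayer : ∀ {n} → Rep n → Fin n → Fin n → Set
SameLayer R i j = LayerBetween R i j ⊎ LayerBetween R j i

lineOf : ∀ {n} → Rep n → Fin n → Fin n
lineOf R v = π R ⟨$⟩ˡ v

Symmetric : ∀ {n} → BoolFun n → Fin n → Fin n → Set
Symmetric f u v = ∀ x → f (λ w → x (transpose u v ⟨$⟩ʳ w)) ≡ f x

module Submission where

-- A representation is evaluated through its firing pattern: line l fires on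
-- input x when its variable takes the canalyzing value a l, and the output is
-- the canalyzed value of the first firing line ('firstHit').  Every pattern is
-- realized by some input.  Swapping the variables u and v (on lines i < j)
-- changes only the firing of lines i and j:
--   * if a i = a j, the two firings are exchanged.  Exchanging never changes
--     the output when lines i..j lie in one layer; conversely, if a line
--     k in [i, j] leaves the layer, the pattern firing exactly at j and k
--     separates f from its swap.
--   * if a i ≠ a j, each of the two lines fires after the swap iff the other
--     one did not.  For a default-normalized representation one of the last
--     two lines k ≠ j (at or after i) outputs the negated default; firing i, j
--     (and k if needed) then exposes a change of output, so u, v are not
--     symmetric.

open import Defs
open import Data.Nat using (ℕ; zero; suc; z≤n; s≤s)
import Data.Nat.Properties as ℕP
open import Data.Fin using (Fin; zero; suc; fromℕ; _<_; _≤_)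
import Data.Fin.Properties as FP
import Data.Fin.Permutation.Components as PC
open import Data.Fin.Permutation using (_⟨$⟩ʳ_; _⟨$⟩ˡ_; transpose; inverseˡ; inverseʳ)
open import Data.Bool using (Bool; true; false; not; if_then_else_)
import Data.Bool.Properties as BP
open import Data.List using (List; []; _∷_; tabulate)
open import Data.List.Properties using (map-tabulate)
open import Data.List.Relation.Unary.All using (All; []; _∷_)
open import Data.List.Relation.Unary.All.Properties using (All¬⇒¬Any)
open import Data.List.Relation.Unary.Any using (here; there; any?)
open import Data.List.Membership.Propositional using (_∈_)
open import Data.Product using (_×_; _,_; proj₂; ∃-syntax)
import Data.Product as Product
open import Data.Sum using (inj₁; inj₂)
import Data.Sum as Sum
open import Data.Empty using (⊥-elim)
open import Function using (_∘_; id)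
open import Function.Bundles using (_⇔_; mk⇔)
open import Function.Construct.Composition using (_⇔-∘_)
open import Relation.Nullary using (yes; no; does; ¬_)
open import Relation.Nullary.Decidable using (dec-true; dec-false)
open import Relation.Binary.Definitions using (tri<; tri≈; tri>)
open import Relation.Binary.PropositionalEquality
  using (_≡_; _≢_; _≗_; refl; sym; trans; cong; module ≡-Reasoning)

open ≡-Reasoning

firstHit : ∀ {n} → (h B : Fin n → Bool) → Bool → Bool
firstHit {zero}  h B d = d
firstHit {suc n} h B d = if h zero then B zero else firstHit (h ∘ suc) (B ∘ suc) d

firstHit-cong : ∀ {n} {h h′ : Fin n → Bool} (B : Fin n → Bool) d →
                h ≗ h′ → firstHit h B d ≡ firstHit h′ B d
firstHit-cong {zero}          B d e = refl
firstHit-cong {suc n} {h′ = h′} B d e rewrite e zero with h′ zero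
... | true  = refl
... | false = firstHit-cong (B ∘ suc) d (e ∘ suc)

firstHit-at : ∀ {n} (h B : Fin n → Bool) d k →
              h k ≡ true → (∀ l → l < k → h l ≡ false) → firstHit h B d ≡ B k
firstHit-at h B d zero    hk _ rewrite hk = refl
firstHit-at h B d (suc k) hk earlier rewrite earlier zero (s≤s z≤n) =
  firstHit-at (h ∘ suc) (B ∘ suc) d k hk (λ l l<k → earlier (suc l) (s≤s l<k))

firstHit-none : ∀ {n} (h B : Fin n → Bool) d → (∀ l → h l ≡ false) → firstHit h B d ≡ d
firstHit-none {zero}  h B d _    = refl
firstHit-none {suc n} h B d none rewrite none zero =
  firstHit-none (h ∘ suc) (B ∘ suc) d (none ∘ suc)

firstHit-within : ∀ {n} (h B : Fin n → Bool) d β {l j : Fin n} →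
                  l ≤ j → h l ≡ true → (∀ k → k ≤ j → B k ≡ β) → firstHit h B d ≡ β
firstHit-within {suc n} h B d β l≤j hl constant with h zero in h0
... | true = constant zero z≤n
firstHit-within {suc n} h B d β {zero} _ hl _ | false with trans (sym hl) h0
... | ()
firstHit-within {suc n} h B d β {suc l} {suc j} (s≤s l≤j) hl constant | false =
  firstHit-within (h ∘ suc) (B ∘ suc) d β l≤j hl (λ k k≤j → constant (suc k) (s≤s k≤j))

-- h′ arises from h by "crossing" lines i and j through φ : Bool → Bool:
-- line i of h′ fires as φ of line j of h and vice versa; the rest is unchanged.
-- φ = id exchanges the two lines, φ = not exchanges and negates them.
record Crossed {n} (φ : Bool → Bool) (i j : Fin n) (h h′ : Fin n → Bool) : Set where
  field
    at-i      : h′ i ≡ φ (h j)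
    at-j      : h′ j ≡ φ (h i)
    elsewhere : ∀ l → l ≢ i → l ≢ j → h′ l ≡ h l

open Crossed

crossed-cong : ∀ {n φ} {i j : Fin n} {h g h′ : Fin n → Bool} →
               h ≗ g → Crossed φ i j h h′ → Crossed φ i j g h′
crossed-cong {φ = φ} {i} {j} e c = record
  { at-i      = trans (at-i c) (cong φ (e j))
  ; at-j      = trans (at-j c) (cong φ (e i))
  ; elsewhere = λ l l≢i l≢j → trans (elsewhere c l l≢i l≢j) (e l)
  }

crossed-tail : ∀ {n φ} {i j : Fin n} {h h′ : Fin (suc n) → Bool} →
               Crossed φ (suc i) (suc j) h h′ → Crossed φ i j (h ∘ suc) (h′ ∘ suc)
crossed-tail c = record
  { at-i      = at-i c
  ; at-j      = at-j c
  ; elsewhere = λ l l≢i l≢j → elsewhere c (suc l) (l≢i ∘ FP.suc-injective) (l≢j ∘ FP.suc-injective)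
  }

firstHit-exchange : ∀ {n} (h h′ B : Fin n → Bool) d {i j : Fin n} → i < j →
                    (∀ k → i ≤ k → k ≤ j → B k ≡ B i) → Crossed id i j h h′ →
                    firstHit h′ B d ≡ firstHit h B d
firstHit-exchange {suc n} h h′ B d {zero} {suc j} _ layer c = byFiring (h zero) (h (suc j)) refl refl
  where
  withinLayer : ∀ g (l : Fin (suc n)) → l ≤ suc j → g l ≡ true → firstHit g B d ≡ B zero
  withinLayer g l l≤j gl = firstHit-within g B d (B zero) l≤j gl (λ k k≤j → layer k z≤n k≤j)

  byFiring : ∀ b₀ bⱼ → h zero ≡ b₀ → h (suc j) ≡ bⱼ → firstHit h′ B d ≡ firstHit h B d
  byFiring true _ h0 _ =
    trans (withinLayer h′ (suc j) ℕP.≤-refl (trans (at-j c) h0)) (sym (withinLayer h zero z≤n h0))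
  byFiring false true _ hj =
    trans (withinLayer h′ zero z≤n (trans (at-i c) hj)) (sym (withinLayer h (suc j) ℕP.≤-refl hj))
  byFiring false false h0 hj = firstHit-cong B d agree
    where
    agree : h′ ≗ h
    agree zero = trans (at-i c) (trans hj (sym h0))
    agree (suc l) with l FP.≟ j
    ... | yes refl = trans (at-j c) (trans h0 (sym hj))
    ... | no l≢j   = elsewhere c (suc l) (λ ()) (l≢j ∘ FP.suc-injective)
firstHit-exchange {suc n} h h′ B d {suc i} {suc j} (s≤s i<j) layer c
  rewrite elsewhere c zero (λ ()) (λ ()) with h zero
... | true  = refl
... | false = firstHit-exchange (h ∘ suc) (h′ ∘ suc) (B ∘ suc) d i<j
                (λ k i≤k k≤j → layer (suc k) (s≤s i≤k) (s≤s k≤j)) (crossed-tail c)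

switchedOff : ∀ {n} {i j : Fin n} {h h′ : Fin n → Bool} → Crossed not i j h h′ →
              h i ≡ true → h j ≡ true →
              ∀ l → (l ≢ i → l ≢ j → h l ≡ false) → h′ l ≡ false
switchedOff {i = i} {j} c hi hj l off with l FP.≟ i | l FP.≟ j
... | yes refl | _        = trans (at-i c) (cong not hj)
... | no _     | yes refl = trans (at-j c) (cong not hi)
... | no l≢i   | no l≢j   = trans (elsewhere c l l≢i l≢j) (off l≢i l≢j)

indicator : ∀ {n} → List (Fin n) → Fin n → Bool
indicator ps l = does (any? (l FP.≟_) ps)

indicator-∈ : ∀ {n} (ps : List (Fin n)) {l} → l ∈ ps → indicator ps l ≡ true
indicator-∈ ps {l} l∈ps = dec-true (any? (l FP.≟_) ps) l∈ps

indicator-∉ : ∀ {n} (ps : List (Fin n)) {l} → All (l ≢_) ps → indicator ps l ≡ false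
indicator-∉ ps {l} l∉ps = dec-false (any? (l FP.≟_) ps) (All¬⇒¬Any l∉ps)

CrossingInvariant : ∀ {n} (φ : Bool → Bool) (i j : Fin n) (B : Fin n → Bool) (d : Bool) → Set
CrossingInvariant φ i j B d =
  ∀ h → ∃[ h′ ] (Crossed φ i j h h′ × firstHit h′ B d ≡ firstHit h B d)

-- Invariance under exchanging lines i < j forces lines i..j into one layer:
-- firing exactly j and k gives B k, its exchange fires i first and gives B i.
exchangeInvariant⇒layer : ∀ {n} {B : Fin n → Bool} {d} {i j : Fin n} → i < j →
                          CrossingInvariant id i j B d → ∀ k → i ≤ k → k ≤ j → B k ≡ B i
exchangeInvariant⇒layer {n} {B} {d} {i} {j} i<j invariant k i≤k k≤j
  with invariant (indicator (j ∷ k ∷ []))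
... | h′ , c , same = begin
  B k                                    ≡⟨ sym firstAtK ⟩
  firstHit (indicator (j ∷ k ∷ [])) B d  ≡⟨ sym same ⟩
  firstHit h′ B d                        ≡⟨ firstAtI ⟩
  B i                                    ∎
  where
  fired : List (Fin n)
  fired = j ∷ k ∷ []

  firstAtK : firstHit (indicator fired) B d ≡ B k
  firstAtK = firstHit-at _ B d k (indicator-∈ fired (there (here refl)))
    (λ l l<k → indicator-∉ fired (FP.<⇒≢ (ℕP.<-≤-trans l<k k≤j) ∷ FP.<⇒≢ l<k ∷ []))

  firstAtI : firstHit h′ B d ≡ B i
  firstAtI = firstHit-at h′ B d i (trans (at-i c) (indicator-∈ fired (here refl)))
    (λ l l<i → trans (elsewhere c l (FP.<⇒≢ l<i) (FP.<⇒≢ (ℕP.<-trans l<i i<j)))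
                     (indicator-∉ fired (FP.<⇒≢ (ℕP.<-trans l<i i<j) ∷ FP.<⇒≢ (ℕP.<-≤-trans l<i i≤k) ∷ [])))

-- If some line k ≥ i other than j outputs the negated default, the list is
-- not invariant under negated crossing of i < j: fire i and j (and k when
-- B i already equals not d); the crossing switches i and j off.
complementNotInvariant : ∀ {n} {B : Fin n → Bool} {d} {i j k : Fin n} →
                         i < j → i ≤ k → k ≢ j → B k ≡ not d →
                         ¬ CrossingInvariant not i j B d
complementNotInvariant {n} {B} {d} {i} {j} {k} i<j i≤k k≢j Bk invariant with B i BP.≟ not d
... | yes Bi with invariant (indicator (i ∷ j ∷ []))
...   | h′ , c , same = BP.not-¬ refl (begin
  d                                      ≡⟨ sym noneFires ⟩
  firstHit h′ B d                        ≡⟨ same ⟩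
  firstHit (indicator (i ∷ j ∷ [])) B d  ≡⟨ firstAtI ⟩
  B i                                    ≡⟨ Bi ⟩
  not d                                  ∎)
  where
  fired : List (Fin n)
  fired = i ∷ j ∷ []

  firstAtI : firstHit (indicator fired) B d ≡ B i
  firstAtI = firstHit-at _ B d i (indicator-∈ fired (here refl))
    (λ l l<i → indicator-∉ fired (FP.<⇒≢ l<i ∷ FP.<⇒≢ (ℕP.<-trans l<i i<j) ∷ []))

  noneFires : firstHit h′ B d ≡ d
  noneFires = firstHit-none h′ B d (λ l →
    switchedOff c (indicator-∈ fired (here refl)) (indicator-∈ fired (there (here refl))) l
                  (λ l≢i l≢j → indicator-∉ fired (l≢i ∷ l≢j ∷ [])))
complementNotInvariant {n} {B} {d} {i} {j} {k} i<j i≤k k≢j Bk invariant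
  | no Bi≢ with invariant (indicator (i ∷ j ∷ k ∷ []))
...   | h′ , c , same = Bi≢ (begin
  B i                                        ≡⟨ sym firstAtI ⟩
  firstHit (indicator (i ∷ j ∷ k ∷ [])) B d  ≡⟨ sym same ⟩
  firstHit h′ B d                            ≡⟨ firstAtK ⟩
  B k                                        ≡⟨ Bk ⟩
  not d                                      ∎)
  where
  k≢i : k ≢ i
  k≢i refl = Bi≢ Bk

  fired : List (Fin n)
  fired = i ∷ j ∷ k ∷ []

  firstAtI : firstHit (indicator fired) B d ≡ B i
  firstAtI = firstHit-at _ B d i (indicator-∈ fired (here refl))
    (λ l l<i → indicator-∉ fired
      (FP.<⇒≢ l<i ∷ FP.<⇒≢ (ℕP.<-trans l<i i<j) ∷ FP.<⇒≢ (ℕP.<-≤-trans l<i i≤k) ∷ []))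

  firstAtK : firstHit h′ B d ≡ B k
  firstAtK = firstHit-at h′ B d k
    (trans (elsewhere c k k≢i k≢j) (indicator-∈ fired (there (there (here refl)))))
    (λ l l<k → switchedOff c (indicator-∈ fired (here refl)) (indicator-∈ fired (there (here refl))) l
                 (λ l≢i l≢j → indicator-∉ fired (l≢i ∷ l≢j ∷ FP.<⇒≢ l<k ∷ [])))

test : Bool → Bool → Bool
test c α = does (c BP.≟ α)

test-different : ∀ {α β} → α ≢ β → ∀ c → test c α ≡ not (test c β)
test-different {false} {false} α≢β _ = ⊥-elim (α≢β refl)
test-different {true}  {true}  α≢β _ = ⊥-elim (α≢β refl)
test-different {false} {true}  _ false = refl
test-different {false} {true}  _ true  = refl
test-different {true}  {false} _ false = refl
test-different {true}  {false} _ true  = refl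

transpose-left : ∀ {n} (u v : Fin n) → PC.transpose u v u ≡ v
transpose-left u v rewrite dec-true (u FP.≟ u) refl = refl

transpose-right : ∀ {n} {u v : Fin n} → u ≢ v → PC.transpose u v v ≡ u
transpose-right {u = u} {v} u≢v
  rewrite dec-false (v FP.≟ u) (u≢v ∘ sym) | dec-true (v FP.≟ v) refl = refl

transpose-other : ∀ {n} {u v w : Fin n} → w ≢ u → w ≢ v → PC.transpose u v w ≡ w
transpose-other {u = u} {v} {w} w≢u w≢v
  rewrite dec-false (w FP.≟ u) w≢u | dec-false (w FP.≟ v) w≢v = refl

symmetric-flip : ∀ {n} {f : BoolFun n} → (∀ {x y} → x ≗ y → f x ≡ f y) →
                 ∀ {u v} → Symmetric f u v → Symmetric f v u
symmetric-flip {f = f} f-cong {u} {v} S x = begin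
  f (λ w → x (PC.transpose v u w))                          ≡⟨ sym (S _) ⟩
  f (λ w → x (PC.transpose v u (PC.transpose u v w)))       ≡⟨ f-cong (λ w → cong x (PC.transpose-inverse v u)) ⟩
  f x                                                       ∎

<⇒≤secondLastLine : ∀ {m} {i j : Fin (suc (suc m))} → i < j → i ≤ secondLastLine m
<⇒≤secondLastLine {m} {i} {j} i<j
  rewrite FP.toℕ-inject₁ (fromℕ m) | FP.toℕ-fromℕ m =
  ℕP.≤-pred (ℕP.≤-trans i<j (FP.toℕ≤pred[n] j))

lastTwoLines : ∀ {m} {i j : Fin (suc (suc m))} → i < j →
               ∃[ k ] (i ≤ k × k ≢ j × (k ≡ secondLastLine m Sum.⊎ k ≡ lastLine m))
lastTwoLines {m} {i} {j} i<j with j FP.≟ lastLine m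
... | yes refl  = secondLastLine m , <⇒≤secondLastLine i<j , FP.fromℕ≢inject₁ ∘ sym , inj₁ refl
... | no j≢last = lastLine m , FP.≤fromℕ i , j≢last ∘ sym , inj₂ refl

evalRules-firstHit : ∀ {N} n (var : Fin n → Fin N) (α β : Fin n → Bool) d x →
  evalRules (tabulate (λ l → var l , α l , β l)) d x ≡ firstHit (λ l → test (x (var l)) (α l)) β d
evalRules-firstHit zero    var α β d x = refl
evalRules-firstHit (suc n) var α β d x with x (var zero) BP.≟ α zero
... | yes _ = refl
... | no _  = evalRules-firstHit n (var ∘ suc) (α ∘ suc) (β ∘ suc) d x

module Semantics (m : ℕ) (R : Rep (suc (suc m))) where

  N : ℕ
  N = suc (suc m)

  default : Bool
  default = not (b R (lastLine m))

  fires : (Fin N → Bool) → Fin N → Bool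
  fires x l = test (x (π R ⟨$⟩ʳ l)) (a R l)

  evalRep-firstHit : ∀ x → evalRep m R x ≡ firstHit (fires x) (b R) default
  evalRep-firstHit x = begin
    evalRep m R x                                                         ≡⟨ cong (λ rs → evalRules rs default x) (map-tabulate id _) ⟩
    evalRules (tabulate (λ l → π R ⟨$⟩ʳ l , a R l , b R l)) default x     ≡⟨ evalRules-firstHit N (π R ⟨$⟩ʳ_) (a R) (b R) default x ⟩
    firstHit (fires x) (b R) default                                      ∎

  value : ∀ {f} → Represents m R f → ∀ x → f x ≡ firstHit (fires x) (b R) default
  value rep x = trans (rep x) (evalRep-firstHit x)

  represented-cong : ∀ {f} → Represents m R f → ∀ {x y} → x ≗ y → f x ≡ f y
  represented-cong rep {x} {y} e =
    trans (value rep x) (trans (firstHit-cong (b R) default (λ l → cong (λ c → test c (a R l)) (e (π R ⟨$⟩ʳ l))))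
                               (sym (value rep y)))

  realize : (Fin N → Bool) → Fin N → Bool
  realize h w = if h (lineOf R w) then a R (lineOf R w) else not (a R (lineOf R w))

  fires-realize : ∀ h → fires (realize h) ≗ h
  fires-realize h l rewrite inverseˡ (π R) {l} with h l
  ... | true  = dec-true (a R l BP.≟ a R l) refl
  ... | false = dec-false (not (a R l) BP.≟ a R l) (BP.not-¬ refl ∘ sym)

  swapInputs : Fin N → Fin N → (Fin N → Bool) → Fin N → Bool
  swapInputs u v x w = x (transpose u v ⟨$⟩ʳ w)

  crossing : ∀ {φ u v} → u ≢ v →
             (∀ c → test c (a R (lineOf R u)) ≡ φ (test c (a R (lineOf R v)))) →
             (∀ c → test c (a R (lineOf R v)) ≡ φ (test c (a R (lineOf R u)))) →
             ∀ x → Crossed φ (lineOf R u) (lineOf R v) (fires x) (fires (swapInputs u v x))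
  crossing {φ} {u} {v} u≢v relᵤ relᵥ x = record
    { at-i      = begin
        test (x (PC.transpose u v (π R ⟨$⟩ʳ i))) (a R i) ≡⟨ cong (λ w → test (x (PC.transpose u v w)) (a R i)) (inverseʳ (π R)) ⟩
        test (x (PC.transpose u v u)) (a R i)            ≡⟨ cong (λ w → test (x w) (a R i)) (transpose-left u v) ⟩
        test (x v) (a R i)                               ≡⟨ relᵤ (x v) ⟩
        φ (test (x v) (a R j))                           ≡⟨ cong (λ w → φ (test (x w) (a R j))) (sym (inverseʳ (π R))) ⟩
        φ (fires x j)                                    ∎
    ; at-j      = begin
        test (x (PC.transpose u v (π R ⟨$⟩ʳ j))) (a R j) ≡⟨ cong (λ w → test (x (PC.transpose u v w)) (a R j)) (inverseʳ (π R)) ⟩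
        test (x (PC.transpose u v v)) (a R j)            ≡⟨ cong (λ w → test (x w) (a R j)) (transpose-right u≢v) ⟩
        test (x u) (a R j)                               ≡⟨ relᵥ (x u) ⟩
        φ (test (x u) (a R i))                           ≡⟨ cong (λ w → φ (test (x w) (a R i))) (sym (inverseʳ (π R))) ⟩
        φ (fires x i)                                    ∎
    ; elsewhere = λ l l≢i l≢j → cong (λ w → test (x w) (a R l))
        (transpose-other (λ e → l≢i (onLine l e)) (λ e → l≢j (onLine l e)))
    }
    where
    i j : Fin N
    i = lineOf R u
    j = lineOf R v
    onLine : ∀ l {w} → π R ⟨$⟩ʳ l ≡ w → l ≡ lineOf R w
    onLine l e = trans (sym (inverseˡ (π R))) (cong (π R ⟨$⟩ˡ_) e)

  symmetric⇒crossingInvariant : ∀ {f φ u v} → Represents m R f →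
    (∀ x → Crossed φ (lineOf R u) (lineOf R v) (fires x) (fires (swapInputs u v x))) →
    Symmetric f u v → CrossingInvariant φ (lineOf R u) (lineOf R v) (b R) default
  symmetric⇒crossingInvariant {f} {u = u} {v} rep crossed S h =
    fires (swapInputs u v x) , crossed-cong (fires-realize h) (crossed x) , (begin
      firstHit (fires (swapInputs u v x)) (b R) default ≡⟨ sym (value rep _) ⟩
      f (swapInputs u v x)                              ≡⟨ S x ⟩
      f x                                               ≡⟨ value rep x ⟩
      firstHit (fires x) (b R) default                  ≡⟨ firstHit-cong (b R) default (fires-realize h) ⟩
      firstHit h (b R) default                          ∎)
    where
    x : Fin N → Bool
    x = realize h

  lastLines-value : DefaultNormalized m R → ∀ {k} → k ≡ secondLastLine m Sum.⊎ k ≡ lastLine m →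
                    b R k ≡ not default
  lastLines-value dn (inj₁ refl) = trans dn (sym (BP.not-involutive _))
  lastLines-value dn (inj₂ refl) = sym (BP.not-involutive _)

  symmetric⇔layer : ∀ {f} → Represents m R f → DefaultNormalized m R →
    ∀ {u v} → u ≢ v → lineOf R u < lineOf R v →
    Symmetric f u v ⇔ (LayerBetween R (lineOf R u) (lineOf R v) × a R (lineOf R u) ≡ a R (lineOf R v))
  symmetric⇔layer {f} rep dn {u} {v} u≢v i<j with a R (lineOf R u) BP.≟ a R (lineOf R v)
  ... | yes same = mk⇔
    (λ S → (ℕP.<⇒≤ i<j , exchangeInvariant⇒layer i<j (symmetric⇒crossingInvariant rep exchanged S)) , same)
    (λ (layer , _) x → begin
      f (swapInputs u v x)                              ≡⟨ value rep _ ⟩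
      firstHit (fires (swapInputs u v x)) (b R) default ≡⟨ firstHit-exchange _ _ (b R) default i<j (proj₂ layer) (exchanged x) ⟩
      firstHit (fires x) (b R) default                  ≡⟨ sym (value rep x) ⟩
      f x                                               ∎)
    where
    exchanged : ∀ x → Crossed id (lineOf R u) (lineOf R v) (fires x) (fires (swapInputs u v x))
    exchanged = crossing u≢v (λ c → cong (test c) same) (λ c → cong (test c) (sym same))
  ... | no differ with lastTwoLines i<j
  ...   | k , i≤k , k≢j , lastTwo = mk⇔
    (λ S → ⊥-elim (complementNotInvariant {B = b R} i<j i≤k k≢j (lastLines-value dn lastTwo)
                     (symmetric⇒crossingInvariant rep complemented S)))
    (λ (_ , same) → ⊥-elim (differ same))
    where
    complemented : ∀ x → Crossed not (lineOf R u) (lineOf R v) (fires x) (fires (swapInputs u v x))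
    complemented = crossing u≢v (test-different differ) (test-different (differ ∘ sym))

  lineOf-injective : ∀ {u v} → lineOf R u ≡ lineOf R v → u ≡ v
  lineOf-injective {u} {v} same = begin
    u                     ≡⟨ sym (inverseʳ (π R)) ⟩
    π R ⟨$⟩ʳ lineOf R u   ≡⟨ cong (π R ⟨$⟩ʳ_) same ⟩
    π R ⟨$⟩ʳ lineOf R v   ≡⟨ inverseʳ (π R) ⟩
    v                     ∎

  symmetric-comm : ∀ {f u v} → Represents m R f → Symmetric f u v ⇔ Symmetric f v u
  symmetric-comm rep = mk⇔ (symmetric-flip (represented-cong rep)) (symmetric-flip (represented-cong rep))

  sameLayer-ordered : ∀ {i j} → i < j → (LayerBetween R i j × a R i ≡ a R j) ⇔ (SameLayer R i j × a R i ≡ a R j)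
  sameLayer-ordered i<j = mk⇔ (Product.map₁ inj₁)
    (Product.map₁ (Sum.[ id , (λ (j≤i , _) → ⊥-elim (ℕP.<⇒≱ i<j j≤i)) ]))

  sameLayer-flip : ∀ {i j} → (SameLayer R j i × a R j ≡ a R i) ⇔ (SameLayer R i j × a R i ≡ a R j)
  sameLayer-flip = mk⇔ (Product.map Sum.swap sym) (Product.map Sum.swap sym)

theorem2 : (m : ℕ) (f : BoolFun (suc (suc m))) (R : Rep (suc (suc m)))
    → Represents m R f → DefaultNormalized m R
    → (u v : Fin (suc (suc m))) → u ≢ v
    → Symmetric f u v ⇔ (SameLayer R (lineOf R u) (lineOf R v) × a R (lineOf R u) ≡ a R (lineOf R v))
theorem2 m f R rep dn u v u≢v with FP.<-cmp (lineOf R u) (lineOf R v)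
... | tri< i<j _ _ = sameLayer-ordered i<j ⇔-∘ symmetric⇔layer rep dn u≢v i<j
  where open Semantics m R
... | tri≈ _ same _ = ⊥-elim (u≢v (lineOf-injective same))
  where open Semantics m R
... | tri> _ _ j<i =
  sameLayer-flip ⇔-∘ (sameLayer-ordered j<i ⇔-∘ (symmetric⇔layer rep dn (u≢v ∘ sym) j<i ⇔-∘ symmetric-comm rep))
  where open Semantics m R
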